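{- Let $X$ be a set of $n$ cards, $a,b,c$ positive integers with $a+b+c=n$, and let $d=a-c\ge 2$ with $b\ge d-1$. Suppose Alice's $(a,b,c)$-strategy is informative for Bob and weakly $(d-1)$-secure against Cathy, and let $\mathcal{A}_i$ be one of its announcements. If $H_A\in\mathcal{A}_i$, $Y\subset H_A$ with $|Y|=c-1$, and $z\in X$ with $z\notin H_A$, then $\mathcal{P}(Y\cup\{z\},i)\neq\emptyset$.
   Context: An $(a,b,c)$-deal is a uniformly random partition of $X$ into Alice's hand $H_A$ ($a$ cards), Bob's hand $H_B$ ($b$ cards) and Cathy's hand $H_C$ ($c$ cards). An announcement is a set of $a$-subsets of $X$. An $(a,b,c)$-strategy consists of announcements $\mathcal{A}_1,\dots,\mathcal{A}_m$ covering all $a$-subsets of $X$ together with, for each $H_A$, a probability distribution $p_{H_A}$ with positive values on $g(H_A)=\{i : H_A\in\mathcal{A}_i\}$; Alice broadcasts an index $i$ chosen according to $p_{H_A}$. For $H\subseteq X$, $\mathcal{P}(H,i)=\{H_A\in\mathcal{A}_i : H_A\cap H=\emptyset\}$. Informative for Bob: $|\mathcal{P}(H_B,i)|\le 1$ for every $b$-subset $H_B$ and every $i$. For $1\le\delta\le a$, the strategy is weakly $\delta$-secure against Cathy if for every $\delta'$ with $1\le\delta'\le\delta$, every $i$, every $c$-subset $H_C$ with $\mathcal{P}(H_C,i)\neq\emptyset$ and all distinct $x_1,\dots,x_{\delta'}\in X\setminus H_C$, $0<\Pr[x_1,\dots,x_{\delta'}\in H_A\mid i,H_C]<1$ (probability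 over the deal and Alice's choice). -}

module Defs where

open import Data.Bool using (Bool; true; false; if_then_else_)
open import Data.Nat using (ℕ; zero; suc; _≤_; _≟_)
open import Data.Fin using (Fin)
open import Data.Fin.Subset using (Subset; ∣_∣; _∩_; _⊆_; Empty; Nonempty; inside; outside)
open import Data.Fin.Subset.Properties using (_⊆?_; nonempty?)
open import Data.List using (List; []; _∷_; map; _++_; allFin; foldr)
open import Data.Vec using (_∷_; [])
open import Data.Product using (Σ; _×_; _,_)
open import Data.Rational using (ℚ; 0ℚ; 1ℚ; _+_; _<_)
open import Relation.Nullary using (¬_; does)
open import Relation.Binary.PropositionalEquality using (_≡_)

allSubsets : (n : ℕ) → List (Subset n)
allSubsets zero = [] ∷ []
allSubsets (suc n) = map (outside ∷_) (allSubsets n) ++ map (inside ∷_) (allSubsets n)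

sumℚ : List ℚ → ℚ
sumℚ = foldr _+_ 0ℚ

Disjoint : {n : ℕ} → Subset n → Subset n → Set
Disjoint A B = Empty (A ∩ B)

disjoint? : {n : ℕ} → Subset n → Subset n → Bool
disjoint? A B = if does (nonempty? (A ∩ B)) then false else true

-- An (a,b,c)-strategy on the card set Fin n: announcements A_1..A_m
-- (given by their characteristic functions on subsets) consisting of
-- a-subsets and covering all a-subsets, together with, for each hand
-- H_A, a probability distribution p H_A on the announcement indices,
-- positive exactly on g(H_A) = { i : H_A ∈ A_i }.
record Strategy (n a : ℕ) : Set where
  field
    m        : ℕ
    ann      : Fin m → Subset n → Bool
    ann-size : ∀ i H → ann i H ≡ true → ∣ H ∣ ≡ a
    cover    : ∀ H → ∣ H ∣ ≡ a → Σ (Fin m) λ i → ann i H ≡ true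
    p        : Subset n → Fin m → ℚ
    p-pos    : ∀ H i → ∣ H ∣ ≡ a → ann i H ≡ true → 0ℚ < p H i
    p-zero   : ∀ H i → ∣ H ∣ ≡ a → ann i H ≡ false → p H i ≡ 0ℚ
    p-sum    : ∀ H → ∣ H ∣ ≡ a → sumℚ (map (p H) (allFin m)) ≡ 1ℚ

open Strategy public

PNonempty : {n a : ℕ} (S : Strategy n a) → Subset n → Fin (m S) → Set
PNonempty S H i = Σ (Subset _) λ HA → (ann S i HA ≡ true) × Disjoint HA H

Informative : {n a : ℕ} (b : ℕ) (S : Strategy n a) → Set
Informative b S = ∀ i HB → ∣ HB ∣ ≡ b → ∀ HA HA′ →
  ann S i HA ≡ true → Disjoint HA HB →
  ann S i HA′ ≡ true → Disjoint HA′ HB → HA ≡ HA′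

-- For a uniformly random (a,b,c)-deal with Cathy's hand fixed to H_C,
-- the possible Alice hands are the a-subsets disjoint from H_C, all
-- equally likely (H_B is then the complement).  The joint probability
-- Pr[E(H_A), i, H_C] equals (number of deals)⁻¹ times the following
-- weight; this constant factor cancels in conditional probabilities.
weight : {n a : ℕ} (S : Strategy n a) → Fin (m S) → Subset n →
         (Subset n → Bool) → ℚ
weight {n} {a} S i HC E = sumℚ (map term (allSubsets n))
  where
  term : Subset n → ℚ
  term H = if does (∣ H ∣ Data.Nat.≟ a)
           then (if disjoint? H HC then (if E H then p S H i else 0ℚ) else 0ℚ)
           else 0ℚ

containsAll : {n : ℕ} → Subset n → Subset n → Bool
containsAll Xs H = does (Xs ⊆? H)

always : {n : ℕ} → Subset n → Bool
always _ = true

-- 0 < Pr[x_1..x_δ' ∈ H_A | i, H_C] < 1, written as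
-- 0 < Pr[E, i, H_C] < Pr[i, H_C] (multiplied through by Pr[i, H_C] > 0).
ProbStrictlyBetween : {n a : ℕ} (S : Strategy n a) → Fin (m S) → Subset n →
                      Subset n → Set
ProbStrictlyBetween S i HC Xs =
  (0ℚ < weight S i HC (containsAll Xs)) ×
  (weight S i HC (containsAll Xs) < weight S i HC always)

WeaklySecure : {n a : ℕ} (c δ : ℕ) (S : Strategy n a) → Set
WeaklySecure c δ S = ∀ δ′ → 1 ≤ δ′ → δ′ ≤ δ → ∀ i HC → ∣ HC ∣ ≡ c →
  PNonempty S HC i →
  ∀ Xs → ∣ Xs ∣ ≡ δ′ → Disjoint Xs HC →
  ProbStrictlyBetween S i HC Xs

-- Two announced hands sharing d = a − c cards coincide: their union has at most
-- a + c cards, so some b-set avoids both, and informativeness for Bob forces them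
-- to be equal.  Take a (c−1)-set B ∋ z avoiding HA.  Weak 1-security, applied to
-- a Cathy hand C ⊇ B avoiding HA and a card w outside HA ∪ C, yields an announced
-- H₁ ≠ HA avoiding B; as HA ─ Y has d + 1 cards, H₁ misses some h ∈ HA ─ Y.  Now
-- B ∪ ⁅h⁆ is a Cathy hand consistent with H₁, and weak (d−1)-security applied to
-- d − 1 cards X ⊆ HA ─ Y ─ ⁅h⁆ yields an announced H′ ⊇ X avoiding B ∪ ⁅h⁆.
-- Since h ∉ H′, H′ ≠ HA, so H′ shares fewer than d cards with HA and thus misses
-- Y; it misses z ∈ B as well.

module Submission where

open import Defs hiding (p)
open import Data.Bool using (true; false; if_then_else_)
open import Data.Empty using (⊥-elim)
open import Data.Fin using (Fin)
open import Data.Fin.Subset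
open import Data.Fin.Subset.Properties
open import Data.List using (List; []; _∷_; map)
open import Data.Nat using (ℕ; zero; suc; _+_; _∸_; _≤_; z≤n; s≤s; _≟_)
open import Data.Nat.Properties as ℕ using ()
open import Data.Nat.Tactic.RingSolver using (solve-∀)
open import Data.Product using (Σ; ∃; _×_; _,_; proj₁)
open import Data.Rational using (ℚ; 0ℚ; _<_) renaming (_+_ to _+ℚ_)
open import Data.Rational.Properties as ℚ using ()
open import Data.Sum using ([_,_]′)
open import Data.Vec using (_∷_; []; here; there)
open import Function using (_∘_)
open import Relation.Binary.PropositionalEquality
open import Relation.Nullary using (Dec; yes; no; does)

private
  variable
    n k : ℕ
    p q r : Subset n
    x : Fin n

∣p∪q∣+∣p∩q∣≡∣p∣+∣q∣ : (p q : Subset n) → ∣ p ∪ q ∣ + ∣ p ∩ q ∣ ≡ ∣ p ∣ + ∣ q ∣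
∣p∪q∣+∣p∩q∣≡∣p∣+∣q∣ [] [] = refl
∣p∪q∣+∣p∩q∣≡∣p∣+∣q∣ (outside ∷ p) (outside ∷ q) = ∣p∪q∣+∣p∩q∣≡∣p∣+∣q∣ p q
∣p∪q∣+∣p∩q∣≡∣p∣+∣q∣ (outside ∷ p) (inside ∷ q) =
  trans (cong suc (∣p∪q∣+∣p∩q∣≡∣p∣+∣q∣ p q)) (sym (ℕ.+-suc _ _))
∣p∪q∣+∣p∩q∣≡∣p∣+∣q∣ (inside ∷ p) (outside ∷ q) = cong suc (∣p∪q∣+∣p∩q∣≡∣p∣+∣q∣ p q)
∣p∪q∣+∣p∩q∣≡∣p∣+∣q∣ (inside ∷ p) (inside ∷ q) =
  cong suc (trans (ℕ.+-suc _ _) (trans (cong suc (∣p∪q∣+∣p∩q∣≡∣p∣+∣q∣ p q)) (sym (ℕ.+-suc _ _))))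

∣p─q∣+∣p∩q∣≡∣p∣ : (p q : Subset n) → ∣ p ─ q ∣ + ∣ p ∩ q ∣ ≡ ∣ p ∣
∣p─q∣+∣p∩q∣≡∣p∣ [] [] = refl
∣p─q∣+∣p∩q∣≡∣p∣ (outside ∷ p) (outside ∷ q) = ∣p─q∣+∣p∩q∣≡∣p∣ p q
∣p─q∣+∣p∩q∣≡∣p∣ (outside ∷ p) (inside ∷ q) = ∣p─q∣+∣p∩q∣≡∣p∣ p q
∣p─q∣+∣p∩q∣≡∣p∣ (inside ∷ p) (outside ∷ q) = cong suc (∣p─q∣+∣p∩q∣≡∣p∣ p q)
∣p─q∣+∣p∩q∣≡∣p∣ (inside ∷ p) (inside ∷ q) = trans (ℕ.+-suc _ _) (cong suc (∣p─q∣+∣p∩q∣≡∣p∣ p q))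

∣p∪q∣≤∣p∣+∣q∣ : (p q : Subset n) → ∣ p ∪ q ∣ ≤ ∣ p ∣ + ∣ q ∣
∣p∪q∣≤∣p∣+∣q∣ p q = ℕ.≤-trans (ℕ.m≤m+n _ _) (ℕ.≤-reflexive (∣p∪q∣+∣p∩q∣≡∣p∣+∣q∣ p q))

∣p∣∸∣q∣≤∣p─q∣ : (p q : Subset n) → ∣ p ∣ ∸ ∣ q ∣ ≤ ∣ p ─ q ∣
∣p∣∸∣q∣≤∣p─q∣ p q = begin
  ∣ p ∣ ∸ ∣ q ∣                 ≤⟨ ℕ.∸-monoʳ-≤ ∣ p ∣ (∣p∩q∣≤∣q∣ p q) ⟩
  ∣ p ∣ ∸ ∣ p ∩ q ∣             ≡⟨ cong (_∸ ∣ p ∩ q ∣) (sym (∣p─q∣+∣p∩q∣≡∣p∣ p q)) ⟩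
  ∣ p ─ q ∣ + ∣ p ∩ q ∣ ∸ ∣ p ∩ q ∣ ≡⟨ ℕ.m+n∸n≡m ∣ p ─ q ∣ ∣ p ∩ q ∣ ⟩
  ∣ p ─ q ∣                     ∎
  where open ℕ.≤-Reasoning

Empty⇒∣p∣≡0 : Empty p → ∣ p ∣ ≡ 0
Empty⇒∣p∣≡0 {n} p-empty = trans (cong ∣_∣ (Empty-unique p-empty)) (∣⊥∣≡0 n)

0<∣p∣⇒Nonempty : 1 ≤ ∣ p ∣ → Nonempty p
0<∣p∣⇒Nonempty {p = p} 1≤∣p∣ with nonempty? p
... | yes p-nonempty = p-nonempty
... | no p-empty = ⊥-elim (ℕ.<-irrefl (sym (Empty⇒∣p∣≡0 p-empty)) 1≤∣p∣)

Empty[p─q]⇒p⊆q : (p q : Subset n) → Empty (p ─ q) → p ⊆ q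
Empty[p─q]⇒p⊆q p q p─q-empty {x} x∈p with x ∈? q
... | yes x∈q = x∈q
... | no x∉q = ⊥-elim (p─q-empty (x , x∈p∧x∉q⇒x∈p─q x∈p x∉q))

x∈p─q⇒x∉q : x ∈ p ─ q → x ∉ q
x∈p─q⇒x∉q {p = inside ∷ p} {q = outside ∷ q} here ()
x∈p─q⇒x∉q {p = _ ∷ p} {q = _ ∷ q} (there x∈p─q) (there x∈q) = x∈p─q⇒x∉q x∈p─q x∈q

subset-of-size : (p : Subset n) → k ≤ ∣ p ∣ → Σ (Subset n) λ q → q ⊆ p × ∣ q ∣ ≡ k
subset-of-size [] z≤n = [] , (λ ()) , refl
subset-of-size (outside ∷ p) k≤∣p∣ with subset-of-size p k≤∣p∣
... | q , q⊆p , ∣q∣≡k = outside ∷ q , out⊆ q⊆p , ∣q∣≡k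
subset-of-size {k = zero} (inside ∷ p) _ with subset-of-size p z≤n
... | q , q⊆p , ∣q∣≡0 = outside ∷ q , out⊆ q⊆p , ∣q∣≡0
subset-of-size {k = suc k} (inside ∷ p) (s≤s k≤∣p∣) with subset-of-size p k≤∣p∣
... | q , q⊆p , ∣q∣≡k = inside ∷ q , s⊆s q⊆p , cong suc ∣q∣≡k

∪-⊆ : p ⊆ r → q ⊆ r → p ∪ q ⊆ r
∪-⊆ {p = p} {q = q} p⊆r q⊆r x∈p∪q = [ p⊆r , q⊆r ]′ (x∈p∪q⁻ p q x∈p∪q)

x∈p⇒⁅x⁆⊆p : x ∈ p → ⁅ x ⁆ ⊆ p
x∈p⇒⁅x⁆⊆p {x = x} x∈p y∈⁅x⁆ = subst (_∈ _) (sym (x∈⁅y⁆⇒x≡y x y∈⁅x⁆)) x∈p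

∣p∣≡0⇒x∉p : ∣ p ∣ ≡ 0 → x ∉ p
∣p∣≡0⇒x∉p {x = x} ∣p∣≡0 x∈p with subst₂ _≤_ (∣⁅x⁆∣≡1 x) ∣p∣≡0 (p⊆q⇒∣p∣≤∣q∣ (x∈p⇒⁅x⁆⊆p x∈p))
... | ()

Disjoint⁺ : (∀ {x} → x ∈ p → x ∉ q) → Disjoint p q
Disjoint⁺ {p = p} {q = q} p∌q (x , x∈p∩q) = let x∈p , x∈q = x∈p∩q⁻ p q x∈p∩q in p∌q x∈p x∈q

Disjoint⁻ : Disjoint p q → x ∈ p → x ∉ q
Disjoint⁻ p∩q-empty x∈p x∈q = p∩q-empty (_ , x∈p∩q⁺ (x∈p , x∈q))

Disjoint-sym : Disjoint p q → Disjoint q p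
Disjoint-sym p∩q-empty = Disjoint⁺ λ x∈q x∈p → Disjoint⁻ p∩q-empty x∈p x∈q

Disjoint-∪ʳ : Disjoint p q → Disjoint p r → Disjoint p (q ∪ r)
Disjoint-∪ʳ {q = q} {r = r} p∩q-empty p∩r-empty = Disjoint⁺ λ x∈p x∈q∪r →
  [ Disjoint⁻ p∩q-empty x∈p , Disjoint⁻ p∩r-empty x∈p ]′ (x∈p∪q⁻ q r x∈q∪r)

Disjoint-⊆ : q ⊆ r → Disjoint p r → Disjoint p q
Disjoint-⊆ q⊆r p∩r-empty = Disjoint⁺ λ x∈p x∈q → Disjoint⁻ p∩r-empty x∈p (q⊆r x∈q)

x∉p⇒Disjoint[p,⁅x⁆] : x ∉ p → Disjoint p ⁅ x ⁆
x∉p⇒Disjoint[p,⁅x⁆] x∉p = Disjoint⁺ λ y∈p y∈⁅x⁆ → x∉p (subst (_∈ _) (x∈⁅y⁆⇒x≡y _ y∈⁅x⁆) y∈p)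

Disjoint⇒∣p∪q∣≡∣p∣+∣q∣ : Disjoint p q → ∣ p ∪ q ∣ ≡ ∣ p ∣ + ∣ q ∣
Disjoint⇒∣p∪q∣≡∣p∣+∣q∣ {p = p} {q = q} p∩q-empty = begin
  ∣ p ∪ q ∣             ≡⟨ sym (ℕ.+-identityʳ _) ⟩
  ∣ p ∪ q ∣ + 0         ≡⟨ cong (∣ p ∪ q ∣ +_) (sym (Empty⇒∣p∣≡0 p∩q-empty)) ⟩
  ∣ p ∪ q ∣ + ∣ p ∩ q ∣ ≡⟨ ∣p∪q∣+∣p∩q∣≡∣p∣+∣q∣ p q ⟩
  ∣ p ∣ + ∣ q ∣         ∎
  where open ≡-Reasoning

x∉p⇒∣p∪⁅x⁆∣≡∣p∣+1 : x ∉ p → ∣ p ∪ ⁅ x ⁆ ∣ ≡ ∣ p ∣ + 1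
x∉p⇒∣p∪⁅x⁆∣≡∣p∣+1 {x = x} x∉p =
  trans (Disjoint⇒∣p∪q∣≡∣p∣+∣q∣ (x∉p⇒Disjoint[p,⁅x⁆] x∉p)) (cong (_ +_) (∣⁅x⁆∣≡1 x))

extend-avoiding : (p q : Subset n) → Disjoint q p → ∣ q ∣ ≤ k → ∣ p ∣ + k ≤ n →
                  Σ (Subset n) λ r → q ⊆ r × Disjoint r p × ∣ r ∣ ≡ k
extend-avoiding {n} {k} p q q∩p-empty ∣q∣≤k ∣p∣+k≤n with subset-of-size (∁ (p ∪ q)) enough
  where
  enough : k ∸ ∣ q ∣ ≤ ∣ ∁ (p ∪ q) ∣
  enough = begin
    k ∸ ∣ q ∣                   ≡⟨ sym (ℕ.[m+n]∸[m+o]≡n∸o (∣ p ∣) k (∣ q ∣)) ⟩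
    ∣ p ∣ + k ∸ (∣ p ∣ + ∣ q ∣)   ≤⟨ ℕ.∸-monoˡ-≤ (∣ p ∣ + ∣ q ∣) ∣p∣+k≤n ⟩
    n ∸ (∣ p ∣ + ∣ q ∣)         ≡⟨ cong (n ∸_) (sym (Disjoint⇒∣p∪q∣≡∣p∣+∣q∣ (Disjoint-sym q∩p-empty))) ⟩
    n ∸ ∣ p ∪ q ∣               ≡⟨ sym (∣∁p∣≡n∸∣p∣ (p ∪ q)) ⟩
    ∣ ∁ (p ∪ q) ∣               ∎
    where open ℕ.≤-Reasoning
... | s , s⊆∁[p∪q] , ∣s∣≡k∸∣q∣ =
  q ∪ s , p⊆p∪q s , Disjoint-sym (Disjoint-∪ʳ (Disjoint-sym q∩p-empty) p∩s-empty) , ∣q∪s∣≡k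
  where
  p∩s-empty : Disjoint p s
  p∩s-empty = Disjoint⁺ λ x∈p x∈s → x∈∁p⇒x∉p (s⊆∁[p∪q] x∈s) (p⊆p∪q q x∈p)
  q∩s-empty : Disjoint q s
  q∩s-empty = Disjoint⁺ λ x∈q x∈s → x∈∁p⇒x∉p (s⊆∁[p∪q] x∈s) (q⊆p∪q p q x∈q)
  ∣q∪s∣≡k : ∣ q ∪ s ∣ ≡ k
  ∣q∪s∣≡k = trans (Disjoint⇒∣p∪q∣≡∣p∣+∣q∣ q∩s-empty)
                  (trans (cong (∣ q ∣ +_) ∣s∣≡k∸∣q∣) (ℕ.m+[n∸m]≡n ∣q∣≤k))

sumℚ-positive⇒∃≢0 : {A : Set} (f : A → ℚ) (xs : List A) → 0ℚ < sumℚ (map f xs) → ∃ λ x → f x ≢ 0ℚ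
sumℚ-positive⇒∃≢0 f [] 0<0 = ⊥-elim (ℚ.<-irrefl refl 0<0)
sumℚ-positive⇒∃≢0 f (x ∷ xs) 0<sum with f x ℚ.≟ 0ℚ
... | no fx≢0 = x , fx≢0
... | yes fx≡0 = sumℚ-positive⇒∃≢0 f xs
  (subst (0ℚ <_) (trans (cong (_+ℚ sumℚ (map f xs)) fx≡0) (ℚ.+-identityˡ _)) 0<sum)

nested-if≢0 : ∀ b₁ b₂ b₃ (x : ℚ) →
  (if b₁ then (if b₂ then (if b₃ then x else 0ℚ) else 0ℚ) else 0ℚ) ≢ 0ℚ →
  b₁ ≡ true × b₂ ≡ true × b₃ ≡ true × x ≢ 0ℚ
nested-if≢0 true true true x x≢0 = refl , refl , refl , x≢0
nested-if≢0 false _ _ _ 0≢0 = ⊥-elim (0≢0 refl)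
nested-if≢0 true false _ _ 0≢0 = ⊥-elim (0≢0 refl)
nested-if≢0 true true false _ 0≢0 = ⊥-elim (0≢0 refl)

does-true⇒ : {P : Set} (P? : Dec P) → does P? ≡ true → P
does-true⇒ (yes p) _ = p
does-true⇒ (no _) ()

disjoint?⇒Disjoint : (p q : Subset n) → disjoint? p q ≡ true → Disjoint p q
disjoint?⇒Disjoint p q p∩q≟∅ with nonempty? (p ∩ q)
... | no p∩q-empty = p∩q-empty
disjoint?⇒Disjoint p q () | yes _

module _ {n a : ℕ} (S : Strategy n a) (i : Fin (m S)) where

  Hand : Subset n → Subset n → Set
  Hand C X = Σ (Subset n) λ H → ann S i H ≡ true × Disjoint H C × X ⊆ H

  -- The summand of `weight`, which Defs binds locally.
  summand≢0⇒Hand : ∀ C X H →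
    (if does (∣ H ∣ ≟ a)
     then (if disjoint? H C then (if containsAll X H then Strategy.p S H i else 0ℚ) else 0ℚ)
     else 0ℚ) ≢ 0ℚ →
    Hand C X
  summand≢0⇒Hand C X H summand≢0 with nested-if≢0 _ _ _ _ summand≢0
  ... | ∣H∣≟a , H∩C≟∅ , X⊆?H , pH≢0 with ann S i H in H∈?
  ...   | true = H , H∈? , disjoint?⇒Disjoint H C H∩C≟∅ , does-true⇒ (X ⊆? H) X⊆?H
  ...   | false = ⊥-elim (pH≢0 (p-zero S H i (does-true⇒ (∣ H ∣ ≟ a) ∣H∣≟a) H∈?))

  PNonempty-⊆ : ∀ {Q R} → Q ⊆ R → PNonempty S R i → PNonempty S Q i
  PNonempty-⊆ Q⊆R (H , H∈ , H∩R-empty) = H , H∈ , Disjoint-⊆ Q⊆R H∩R-empty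

  positive-weight⇒Hand : ∀ C X → 0ℚ < weight S i C (containsAll X) → Hand C X
  positive-weight⇒Hand C X 0<weight =
    let H , summand≢0 = sumℚ-positive⇒∃≢0 _ (allSubsets n) 0<weight in summand≢0⇒Hand C X H summand≢0

module _ {n a b c d : ℕ} {S : Strategy n a} (informative : Informative b S)
         (a+b+c≡n : a + b + c ≡ n) (c+d≡a : c + d ≡ a) {i : Fin (m S)} where

  private
    a+c≤n : a + c ≤ n
    a+c≤n = ℕ.≤-trans (ℕ.+-monoˡ-≤ c (ℕ.m≤m+n a b)) (ℕ.≤-reflexive a+b+c≡n)

    n∸[a+c]≡b : n ∸ (a + c) ≡ b
    n∸[a+c]≡b = begin
      n ∸ (a + c)         ≡⟨ cong (_∸ (a + c)) (sym a+b+c≡n) ⟩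
      a + b + c ∸ (a + c) ≡⟨ cong (_∸ (a + c)) (swap a b c) ⟩
      a + c + b ∸ (a + c) ≡⟨ ℕ.m+n∸m≡n (a + c) b ⟩
      b                   ∎
      where
      open ≡-Reasoning
      swap : ∀ x y z → x + y + z ≡ x + z + y
      swap = solve-∀

    b+∣H∪H′∣≤n : ∀ u s → u + s ≡ a + a → d ≤ s → b + u ≤ n
    b+∣H∪H′∣≤n u s u+s≡a+a d≤s = ℕ.+-cancelʳ-≤ d (b + u) n (begin
      b + u + d         ≤⟨ ℕ.+-monoʳ-≤ (b + u) d≤s ⟩
      b + u + s         ≡⟨ ℕ.+-assoc b u s ⟩
      b + (u + s)       ≡⟨ cong (b +_) u+s≡a+a ⟩
      b + (a + a)       ≡⟨ cong (λ t → b + (a + t)) (sym c+d≡a) ⟩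
      b + (a + (c + d)) ≡⟨ regroup a b c d ⟩
      a + b + c + d     ≡⟨ cong (_+ d) a+b+c≡n ⟩
      n + d             ∎)
      where
      open ℕ.≤-Reasoning
      regroup : ∀ x y z t → y + (x + (z + t)) ≡ x + y + z + t
      regroup = solve-∀

    ∣HA∣+k≤n : ∀ {HA k} → ann S i HA ≡ true → k ≤ c → ∣ HA ∣ + k ≤ n
    ∣HA∣+k≤n HA∈ k≤c = subst (λ t → t + _ ≤ n) (sym (ann-size S i _ HA∈))
                             (ℕ.≤-trans (ℕ.+-monoʳ-≤ a k≤c) a+c≤n)

    ∣∁[HA∪C]∣≡b : ∀ {HA C} → ann S i HA ≡ true → Disjoint HA C → ∣ C ∣ ≡ c → ∣ ∁ (HA ∪ C) ∣ ≡ b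
    ∣∁[HA∪C]∣≡b {HA} {C} HA∈ HA∩C-empty ∣C∣≡c = begin
      ∣ ∁ (HA ∪ C) ∣     ≡⟨ ∣∁p∣≡n∸∣p∣ (HA ∪ C) ⟩
      n ∸ ∣ HA ∪ C ∣     ≡⟨ cong (n ∸_) (Disjoint⇒∣p∪q∣≡∣p∣+∣q∣ HA∩C-empty) ⟩
      n ∸ (∣ HA ∣ + ∣ C ∣) ≡⟨ cong (n ∸_) (cong₂ _+_ (ann-size S i HA HA∈) ∣C∣≡c) ⟩
      n ∸ (a + c)        ≡⟨ n∸[a+c]≡b ⟩
      b                  ∎
      where open ≡-Reasoning

    a∸c≡d : a ∸ c ≡ d
    a∸c≡d = trans (cong (_∸ c) (sym c+d≡a)) (ℕ.m+n∸m≡n c d)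

  d≤∣HA─Y∣ : ∀ {HA Y} → ann S i HA ≡ true → ∣ Y ∣ ≤ c → d ≤ ∣ HA ─ Y ∣
  d≤∣HA─Y∣ {HA} {Y} HA∈ ∣Y∣≤c = begin
    d              ≡⟨ sym a∸c≡d ⟩
    a ∸ c          ≤⟨ ℕ.∸-monoʳ-≤ a ∣Y∣≤c ⟩
    a ∸ ∣ Y ∣      ≡⟨ cong (_∸ ∣ Y ∣) (sym (ann-size S i HA HA∈)) ⟩
    ∣ HA ∣ ∸ ∣ Y ∣ ≤⟨ ∣p∣∸∣q∣≤∣p─q∣ HA Y ⟩
    ∣ HA ─ Y ∣     ∎
    where open ℕ.≤-Reasoning

  hands-sharing-d-cards-coincide : ∀ {H H′ X} → ann S i H ≡ true → ann S i H′ ≡ true →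
                                   X ⊆ H → X ⊆ H′ → d ≤ ∣ X ∣ → H ≡ H′
  hands-sharing-d-cards-coincide {H} {H′} {X} H∈ H′∈ X⊆H X⊆H′ d≤∣X∣
    with subset-of-size (∁ (H ∪ H′)) b≤∣∁[H∪H′]∣
    where
    b≤∣∁[H∪H′]∣ : b ≤ ∣ ∁ (H ∪ H′) ∣
    b≤∣∁[H∪H′]∣ = subst (b ≤_) (sym (∣∁p∣≡n∸∣p∣ (H ∪ H′))) (ℕ.m+n≤o⇒m≤o∸n b
      (b+∣H∪H′∣≤n ∣ H ∪ H′ ∣ ∣ H ∩ H′ ∣
        (trans (∣p∪q∣+∣p∩q∣≡∣p∣+∣q∣ H H′) (cong₂ _+_ (ann-size S i H H∈) (ann-size S i H′ H′∈)))
        (ℕ.≤-trans d≤∣X∣ (p⊆q⇒∣p∣≤∣q∣ λ x∈X → x∈p∩q⁺ (X⊆H x∈X , X⊆H′ x∈X)))))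
  ... | B , B⊆∁[H∪H′] , ∣B∣≡b =
    informative i B ∣B∣≡b H H′ H∈ (avoids (p⊆p∪q H′)) H′∈ (avoids (q⊆p∪q H H′))
    where
    avoids : ∀ {G} → G ⊆ H ∪ H′ → Disjoint G B
    avoids G⊆H∪H′ = Disjoint⁺ λ x∈G x∈B → x∈∁p⇒x∉p (B⊆∁[H∪H′] x∈B) (G⊆H∪H′ x∈G)

  distinct-hand-misses-HA─Y : ∀ {HA H Y} → ann S i HA ≡ true → ann S i H ≡ true → H ≢ HA →
                              ∣ Y ∣ ≤ c → Nonempty (HA ─ Y ─ H)
  distinct-hand-misses-HA─Y {HA} {H} {Y} HA∈ H∈ H≢HA ∣Y∣≤c with nonempty? (HA ─ Y ─ H)
  ... | yes missed = missed
  ... | no none = ⊥-elim (H≢HA (sym (hands-sharing-d-cards-coincide HA∈ H∈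
                    (p─q⊆p HA Y) (Empty[p─q]⇒p⊆q (HA ─ Y) H none) (d≤∣HA─Y∣ HA∈ ∣Y∣≤c))))

  distinct-hand-through-X-avoids-Y : ∀ {HA H X Y} → ann S i HA ≡ true → ann S i H ≡ true → H ≢ HA →
                                     Y ⊆ HA → X ⊆ HA ─ Y → X ⊆ H → d ≤ ∣ X ∣ + 1 → Disjoint H Y
  distinct-hand-through-X-avoids-Y {HA} {H} {X} {Y} HA∈ H∈ H≢HA Y⊆HA X⊆HA─Y X⊆H d≤∣X∣+1 =
    Disjoint⁺ λ {x} x∈H x∈Y → H≢HA (sym (hands-sharing-d-cards-coincide HA∈ H∈
      (∪-⊆ (p─q⊆p HA Y ∘ X⊆HA─Y) (x∈p⇒⁅x⁆⊆p (Y⊆HA x∈Y)))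
      (∪-⊆ X⊆H (x∈p⇒⁅x⁆⊆p x∈H))
      (subst (d ≤_) (sym (x∉p⇒∣p∪⁅x⁆∣≡∣p∣+1 λ x∈X → x∈p─q⇒x∉q (X⊆HA─Y x∈X) x∈Y)) d≤∣X∣+1)))

  distinct-hand-with-common-gap :
    ∀ {δ HA z} → WeaklySecure c δ S → 1 ≤ δ → 2 ≤ c → 1 ≤ b → ann S i HA ≡ true → z ∉ HA →
    Σ (Subset n) λ H₁ → ann S i H₁ ≡ true × H₁ ≢ HA ×
      Σ (Subset n) λ B → z ∈ B × Disjoint B HA × Disjoint H₁ B × ∣ B ∣ ≡ c ∸ 1
  distinct-hand-with-common-gap {HA = HA} {z} secure 1≤δ 2≤c 1≤b HA∈ z∉HA
    with extend-avoiding HA ⁅ z ⁆ (Disjoint-sym (x∉p⇒Disjoint[p,⁅x⁆] z∉HA))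
           (subst (_≤ c ∸ 1) (sym (∣⁅x⁆∣≡1 z)) (ℕ.∸-monoˡ-≤ 1 2≤c)) (∣HA∣+k≤n HA∈ (ℕ.m∸n≤m c 1))
  ... | B , ⁅z⁆⊆B , B∩HA-empty , ∣B∣≡c∸1
    with extend-avoiding HA B B∩HA-empty (ℕ.≤-trans (ℕ.≤-reflexive ∣B∣≡c∸1) (ℕ.m∸n≤m c 1))
           (∣HA∣+k≤n HA∈ ℕ.≤-refl)
  ... | C , B⊆C , C∩HA-empty , ∣C∣≡c
    with 0<∣p∣⇒Nonempty (subst (1 ≤_) (sym (∣∁[HA∪C]∣≡b HA∈ (Disjoint-sym C∩HA-empty) ∣C∣≡c)) 1≤b)
  ... | w , w∈∁[HA∪C]
    with positive-weight⇒Hand S i C ⁅ w ⁆ (proj₁ (secure 1 ℕ.≤-refl 1≤δ i C ∣C∣≡c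
           (HA , HA∈ , Disjoint-sym C∩HA-empty) ⁅ w ⁆ (∣⁅x⁆∣≡1 w)
           (Disjoint-sym (x∉p⇒Disjoint[p,⁅x⁆] λ w∈C → x∈∁p⇒x∉p w∈∁[HA∪C] (q⊆p∪q HA C w∈C)))))
  ... | H₁ , H₁∈ , H₁∩C-empty , ⁅w⁆⊆H₁ =
    H₁ , H₁∈ , H₁≢HA , B , ⁅z⁆⊆B (x∈⁅x⁆ z) , B∩HA-empty , Disjoint-⊆ B⊆C H₁∩C-empty , ∣B∣≡c∸1
    where
    H₁≢HA : H₁ ≢ HA
    H₁≢HA refl = x∈∁p⇒x∉p w∈∁[HA∪C] (p⊆p∪q C (⁅w⁆⊆H₁ (x∈⁅x⁆ w)))

  hand-avoiding-Y∪B :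
    ∀ {HA H₁ Y B} → WeaklySecure c (d ∸ 1) S → 2 ≤ d → 1 ≤ c →
    ann S i HA ≡ true → Y ⊆ HA → ∣ Y ∣ ≡ c ∸ 1 →
    ann S i H₁ ≡ true → H₁ ≢ HA → Disjoint B HA → Disjoint H₁ B → ∣ B ∣ ≡ c ∸ 1 →
    PNonempty S (Y ∪ B) i
  hand-avoiding-Y∪B {HA} {H₁} {Y} {B} secure 2≤d 1≤c HA∈ Y⊆HA ∣Y∣≡c∸1 H₁∈ H₁≢HA
                    B∩HA-empty H₁∩B-empty ∣B∣≡c∸1
    with distinct-hand-misses-HA─Y HA∈ H₁∈ H₁≢HA (ℕ.≤-trans (ℕ.≤-reflexive ∣Y∣≡c∸1) (ℕ.m∸n≤m c 1))
  ... | h , h∈HA─Y─H₁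
    with subset-of-size (HA ─ Y ─ ⁅ h ⁆) d∸1≤∣HA─Y─⁅h⁆∣
    where
    ∣Y∪⁅h⁆∣≤c : ∣ Y ∪ ⁅ h ⁆ ∣ ≤ c
    ∣Y∪⁅h⁆∣≤c = ℕ.≤-trans (∣p∪q∣≤∣p∣+∣q∣ Y ⁅ h ⁆)
                  (ℕ.≤-reflexive (trans (cong₂ _+_ ∣Y∣≡c∸1 (∣⁅x⁆∣≡1 h)) (ℕ.m∸n+n≡m 1≤c)))
    d∸1≤∣HA─Y─⁅h⁆∣ : d ∸ 1 ≤ ∣ HA ─ Y ─ ⁅ h ⁆ ∣
    d∸1≤∣HA─Y─⁅h⁆∣ = ℕ.≤-trans (ℕ.m∸n≤m d 1)
      (subst (λ t → d ≤ ∣ t ∣) (sym (p─q─r≡p─q∪r HA Y ⁅ h ⁆)) (d≤∣HA─Y∣ HA∈ ∣Y∪⁅h⁆∣≤c))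
  ... | X , X⊆HA─Y─⁅h⁆ , ∣X∣≡d∸1
    with positive-weight⇒Hand S i (B ∪ ⁅ h ⁆) X
           (proj₁ (secure (d ∸ 1) (ℕ.∸-monoˡ-≤ 1 2≤d) ℕ.≤-refl i (B ∪ ⁅ h ⁆) ∣B∪⁅h⁆∣≡c
                          (H₁ , H₁∈ , H₁∩B∪⁅h⁆-empty) X ∣X∣≡d∸1 X∩B∪⁅h⁆-empty))
    where
    h∉B : h ∉ B
    h∉B = Disjoint⁻ (Disjoint-sym B∩HA-empty) (p─q⊆p HA Y (p─q⊆p (HA ─ Y) H₁ h∈HA─Y─H₁))
    ∣B∪⁅h⁆∣≡c : ∣ B ∪ ⁅ h ⁆ ∣ ≡ c
    ∣B∪⁅h⁆∣≡c = trans (x∉p⇒∣p∪⁅x⁆∣≡∣p∣+1 h∉B) (trans (cong (_+ 1) ∣B∣≡c∸1) (ℕ.m∸n+n≡m 1≤c))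
    H₁∩B∪⁅h⁆-empty : Disjoint H₁ (B ∪ ⁅ h ⁆)
    H₁∩B∪⁅h⁆-empty = Disjoint-∪ʳ H₁∩B-empty (x∉p⇒Disjoint[p,⁅x⁆] (x∈p─q⇒x∉q h∈HA─Y─H₁))
    X∩B∪⁅h⁆-empty : Disjoint X (B ∪ ⁅ h ⁆)
    X∩B∪⁅h⁆-empty = Disjoint-∪ʳ
      (Disjoint-sym (Disjoint-⊆ (p─q⊆p HA Y ∘ p─q⊆p (HA ─ Y) ⁅ h ⁆ ∘ X⊆HA─Y─⁅h⁆) B∩HA-empty))
      (Disjoint⁺ λ x∈X → x∈p─q⇒x∉q (X⊆HA─Y─⁅h⁆ x∈X))
  ... | H′ , H′∈ , H′∩B∪⁅h⁆-empty , X⊆H′ =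
    H′ , H′∈ , Disjoint-∪ʳ
      (distinct-hand-through-X-avoids-Y HA∈ H′∈ H′≢HA Y⊆HA (p─q⊆p (HA ─ Y) ⁅ h ⁆ ∘ X⊆HA─Y─⁅h⁆) X⊆H′
         (ℕ.≤-reflexive (sym (trans (cong (_+ 1) ∣X∣≡d∸1) (ℕ.m∸n+n≡m (ℕ.<⇒≤ 2≤d))))))
      (Disjoint-⊆ (p⊆p∪q ⁅ h ⁆) H′∩B∪⁅h⁆-empty)
    where
    H′≢HA : H′ ≢ HA
    H′≢HA refl = Disjoint⁻ H′∩B∪⁅h⁆-empty (p─q⊆p HA Y (p─q⊆p (HA ─ Y) H₁ h∈HA─Y─H₁))
                           (q⊆p∪q B ⁅ h ⁆ (x∈⁅x⁆ h))

  hand-avoiding-Y∪⁅z⁆ :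
    ∀ {HA Y z} → WeaklySecure c (d ∸ 1) S → 2 ≤ c → 2 ≤ d → 1 ≤ b →
    ann S i HA ≡ true → Y ⊆ HA → ∣ Y ∣ ≡ c ∸ 1 → z ∉ HA → PNonempty S (Y ∪ ⁅ z ⁆) i
  hand-avoiding-Y∪⁅z⁆ {HA} {Y} {z} secure 2≤c 2≤d 1≤b HA∈ Y⊆HA ∣Y∣≡c∸1 z∉HA =
    let H₁ , H₁∈ , H₁≢HA , B , z∈B , B∩HA-empty , H₁∩B-empty , ∣B∣≡c∸1 =
          distinct-hand-with-common-gap secure (ℕ.∸-monoˡ-≤ 1 2≤d) 2≤c 1≤b HA∈ z∉HA
    in PNonempty-⊆ S i (∪-⊆ (p⊆p∪q B) (x∈p⇒⁅x⁆⊆p (q⊆p∪q Y B z∈B)))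
         (hand-avoiding-Y∪B {H₁ = H₁} {B = B} secure 2≤d (ℕ.<⇒≤ 2≤c) HA∈ Y⊆HA ∣Y∣≡c∸1 H₁∈ H₁≢HA
            B∩HA-empty H₁∩B-empty ∣B∣≡c∸1)

lemma13 : (n a b c : ℕ) → 1 ≤ a → 1 ≤ b → 1 ≤ c → a + b + c ≡ n →
          2 ≤ a ∸ c → (a ∸ c) ∸ 1 ≤ b →
          (S : Strategy n a) → Informative b S → WeaklySecure c ((a ∸ c) ∸ 1) S →
          (i : Fin (m S)) (HA : Subset n) → ann S i HA ≡ true →
          (Y : Subset n) → Y ⊂ HA → ∣ Y ∣ ≡ c ∸ 1 →
          (z : Fin n) → z ∉ HA →
          PNonempty S (Y ∪ ⁅ z ⁆) i
lemma13 n a b 1 _ _ _ _ _ _ S _ _ i HA HA∈ Y _ ∣Y∣≡0 z z∉HA =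
  HA , HA∈ , Disjoint-∪ʳ (Disjoint⁺ λ _ → ∣p∣≡0⇒x∉p ∣Y∣≡0) (x∉p⇒Disjoint[p,⁅x⁆] z∉HA)
lemma13 n a b c@(suc (suc _)) _ 1≤b _ a+b+c≡n 2≤d _ S informative secure i HA HA∈ Y Y⊂HA ∣Y∣≡c∸1 z z∉HA =
  hand-avoiding-Y∪⁅z⁆ {S = S} informative a+b+c≡n c+d≡a secure (s≤s (s≤s z≤n)) 2≤d 1≤b
    HA∈ (p⊂q⇒p⊆q Y⊂HA) ∣Y∣≡c∸1 z∉HA
  where
  c+d≡a : c + (a ∸ c) ≡ a
  c+d≡a = ℕ.m+[n∸m]≡n {c} {a} (ℕ.<⇒≤ (ℕ.m∸n≢0⇒n<m {a} {c} (ℕ.>⇒≢ (ℕ.<⇒≤ 2≤d))))
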